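{- Let $n=6k+2$ with $k\ge 6$, and let $P(n,3)$ be the generalized Petersen graph with vertex set $\{u_1,\dots,u_n,v_1,\dots,v_n\}$ and edge set $\{u_iu_{i+1},\,u_iv_i,\,v_iv_{i+3}:1\le i\le n\}$ (subscripts modulo $n$). Then $\dim(P(n,3))\ge 4$.
   Context: For a connected graph $G$, an ordered set $W=\{w_1,\dots,w_m\}\subseteq V(G)$ is a resolving set if the vectors $r(z|W)=(d(z,w_1),\dots,d(z,w_m))$ of shortest-path distances are pairwise distinct over all $z\in V(G)$. The metric dimension $\dim(G)$ is the minimum cardinality of a resolving set of $G$. -}

module Defs where

open import Data.Nat using (ℕ; zero; suc; _+_; _*_; _≤_; _%_; NonZero)
open import Data.Fin using (Fin; toℕ)
open import Data.Product using (_×_)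
open import Data.Sum using (_⊎_)
open import Relation.Binary.PropositionalEquality using (_≡_)

-- Vertices of the generalized Petersen graph P(n,3):
-- u i (outer) and v i (inner), i ∈ {0,…,n-1} (0-based indices, mod n).
data PVertex (n : ℕ) : Set where
  u : Fin n → PVertex n
  v : Fin n → PVertex n

data PEdge (n : ℕ) .{{_ : NonZero n}} : PVertex n → PVertex n → Set where
  outer : (i j : Fin n) → toℕ j ≡ (toℕ i + 1) % n → PEdge n (u i) (u j)
  spoke : (i : Fin n) → PEdge n (u i) (v i)
  inner : (i j : Fin n) → toℕ j ≡ (toℕ i + 3) % n → PEdge n (v i) (v j)

Adj : (n : ℕ) .{{_ : NonZero n}} → PVertex n → PVertex n → Set
Adj n x y = PEdge n x y ⊎ PEdge n y x

data Walk (n : ℕ) .{{_ : NonZero n}} : PVertex n → PVertex n → ℕ → Set where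
  here : ∀ {x} → Walk n x x zero
  step : ∀ {x y z m} → Adj n x y → Walk n y z m → Walk n x z (suc m)

IsDist : (n : ℕ) .{{_ : NonZero n}} → PVertex n → PVertex n → ℕ → Set
IsDist n x y d = Walk n x y d × (∀ m → Walk n x y m → d ≤ m)

Resolving : (n : ℕ) .{{_ : NonZero n}} → {m : ℕ} → (Fin m → PVertex n) → Set
Resolving n {m} W =
  ∀ (z z' : PVertex n) →
  (∀ (i : Fin m) (d d' : ℕ) → IsDist n z (W i) d → IsDist n z' (W i) d' → d ≡ d') →
  z ≡ z'

{-# OPTIONS --safe #-}
-- Distances in P(n,3) are explicit. Lift to the infinite cover P(ℤ,3), where the distance
-- to a base vertex grows by one every three positions; the distance in P(n,3) at cyclic
-- offset c is the smaller of the cover distances at offsets c and n − c. This formula is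
-- the distance because it vanishes only at the base vertex, changes by at most one along
-- every edge, and decreases along some edge at every other vertex.
--
-- For n = 6k + 2 the formula shows that u_i and u_{i+2} are equidistant from w = u_j or v_j
-- whenever i − j − 3k ≡ 3δ with δ in an explicit set Good ⊆ [0, 5k]. As 3 is invertible
-- modulo n, three vertices fail to resolve some such pair as soon as any three residues
-- y₁, y₂, y₃ have a common point in their translates y_l + Good. Cutting the cycle at the
-- y_l, the two gaps other than the largest are small enough that one of the shifts
-- 0, k + 2, k + 3 works.
module Submission where

open import Defs
open import Data.Bool.Base using (T)
open import Data.Empty using (⊥; ⊥-elim)
open import Data.Fin using (Fin; toℕ; fromℕ<) renaming (zero to fzero; suc to fsuc)
open import Data.Fin.Properties using (toℕ-fromℕ<; toℕ-injective; toℕ<n) renaming (_≟_ to _≟ᶠ_)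
open import Data.List using ([]; _∷_)
open import Data.Nat
open import Data.Nat.DivMod
open import Data.Nat.Properties
open import Data.Nat.Tactic.RingSolver using (solve)
open import Algebra.Properties.CommutativeSemigroup +-commutativeSemigroup using (xy∙z≈xz∙y)
open import Data.Product using (∃-syntax; _×_; _,_; proj₁; proj₂)
open import Data.Sum using (_⊎_; inj₁; inj₂)
import Data.Sum as Sum
open import Function.Definitions using (Injective)
open import Relation.Binary.Bundles using (Setoid)
open import Relation.Binary.Definitions using (DecidableEquality)
open import Relation.Binary.PropositionalEquality
import Relation.Binary.Reasoning.Setoid as SetoidReasoning
open import Relation.Binary.Structures using (IsEquivalence)
open import Relation.Nullary using (¬_; yes; no)
open import Relation.Nullary.Decidable using (map′)

≤-eval : ∀ {m n} {_ : T (m ≤ᵇ n)} → m ≤ n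
≤-eval {m} {n} {m≤ᵇn} = ≤ᵇ⇒≤ m n m≤ᵇn

+≡⇒∸≡ : ∀ {a b c} → a + b ≡ c → c ∸ a ≡ b
+≡⇒∸≡ {a} {b} refl = m+n∸m≡n a b

<-of-sum : ∀ {a b c} → a + suc b ≡ c → a < c
<-of-sum {a} {b} refl = m<m+n a z<s

+-rotate : ∀ x y z → y + z + x ≡ x + y + z
+-rotate x y z = trans (+-comm (y + z) x) (sym (+-assoc x y z))

largest-of-three : ∀ a b c → (b ≤ a × c ≤ a) ⊎ (c ≤ b × a ≤ b) ⊎ (a ≤ c × b ≤ c)
largest-of-three a b c with ≤-total b a | ≤-total c a | ≤-total c b
... | inj₁ b≤a | inj₁ c≤a | _ = inj₁ (b≤a , c≤a)
... | inj₁ b≤a | inj₂ a≤c | _ = inj₂ (inj₂ (a≤c , ≤-trans b≤a a≤c))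
... | inj₂ a≤b | _ | inj₁ c≤b = inj₂ (inj₁ (c≤b , a≤b))
... | inj₂ a≤b | _ | inj₂ b≤c = inj₂ (inj₂ (≤-trans a≤b b≤c , b≤c))

compare-near : ∀ m p → m < p ⊎ m ≡ p ⊎ m ≡ p + 1 ⊎ m ≡ p + 2 ⊎ p + 3 ≤ m
compare-near zero zero = inj₂ (inj₁ refl)
compare-near zero (suc p) = inj₁ z<s
compare-near 1 zero = inj₂ (inj₂ (inj₁ refl))
compare-near 2 zero = inj₂ (inj₂ (inj₂ (inj₁ refl)))
compare-near (suc (suc (suc m))) zero = inj₂ (inj₂ (inj₂ (inj₂ (s≤s (s≤s (s≤s z≤n))))))
compare-near (suc m) (suc p) =
  Sum.map s<s (Sum.map (cong suc) (Sum.map (cong suc) (Sum.map (cong suc) s≤s))) (compare-near m p)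

≤-by-slack : ∀ {x y} s → y ≡ x + s → x ≤ y
≤-by-slack {x} s y≡x+s = subst (x ≤_) (sym y≡x+s) (m≤m+n x s)

-- l ≤ r is a sum of hypotheses and s the slack of the linear combination
≤-by-certificate : ∀ {x y l r} s → l ≤ r → y + l ≡ x + r + s → x ≤ y
≤-by-certificate {x} {y} {l} {r} s l≤r y+l≡x+r+s =
  +-cancelʳ-≤ r x y
    (≤-trans (m≤m+n (x + r) s) (≤-trans (≤-reflexive (sym y+l≡x+r+s)) (+-monoʳ-≤ y l≤r)))

≡-by-certificate : ∀ {x y l r} → l ≡ r → x + l ≡ y + r → x ≡ y
≡-by-certificate {x} {y} {l} l≡r x+l≡y+r = +-cancelʳ-≡ l x y (trans x+l≡y+r (cong (y +_) (sym l≡r)))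

⊥-by-certificate : ∀ {l r} s → l ≤ r → l ≡ r + suc s → ⊥
⊥-by-certificate {l} {r} s l≤r l≡r+1+s = <⇒≱ (subst (r <_) (sym l≡r+1+s) (m<m+n r z<s)) l≤r

Within₁ : ℕ → ℕ → Set
Within₁ x y = x ≤ suc y × y ≤ suc x

within₁-sym : ∀ {x y} → Within₁ x y → Within₁ y x
within₁-sym (x≤1+y , y≤1+x) = y≤1+x , x≤1+y

within₁-suc : ∀ x → Within₁ x (suc x)
within₁-suc x = m≤n+m x 2 , ≤-refl

within₁-cong-suc : ∀ {x y} → Within₁ x y → Within₁ (suc x) (suc y)
within₁-cong-suc (x≤1+y , y≤1+x) = s≤s x≤1+y , s≤s y≤1+x

⊓-within₁ : ∀ {a a′ b b′} → Within₁ a a′ → Within₁ b b′ → Within₁ (a ⊓ b) (a′ ⊓ b′)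
⊓-within₁ (a≤ , ≤a) (b≤ , ≤b) = ⊓-mono-≤ a≤ b≤ , ⊓-mono-≤ ≤a ≤b

⊓-within₁-first : ∀ {a a′ b b′} → Within₁ a b → a ≤ suc b′ → b ≤ suc a′ →
                  Within₁ (a ⊓ a′) (b ⊓ b′)
⊓-within₁-first {a} {a′} {b} {b′} (a≤1+b , b≤1+a) a≤1+b′ b≤1+a′ =
  ⊓-glb (≤-trans (m⊓n≤m a a′) a≤1+b) (≤-trans (m⊓n≤m a a′) a≤1+b′) ,
  ⊓-glb (≤-trans (m⊓n≤m b b′) b≤1+a) (≤-trans (m⊓n≤m b b′) b≤1+a′)

data Layer : Set where
  U V : Layer

other : Layer → Layer
other U = V
other V = U

stride : Layer → ℕ
stride U = 1
stride V = 3

-- Distances in the infinite cover P(ℤ,3) of P(n,3): dUU t = d(u_t, u_0), dUV t = d(u_t, v_0)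
-- = d(v_t, u_0) and dVV t = d(v_t, v_0). Past a short initial segment, three more positions
-- always cost exactly one more step.
dUU dUV dVV : ℕ → ℕ
dUU 0 = 0
dUU 1 = 1
dUU 2 = 2
dUU 3 = 3
dUU 4 = 4
dUU 5 = 5
dUU (suc (suc (suc t@(suc (suc (suc _)))))) = suc (dUU t)

dUV 0 = 1
dUV 1 = 2
dUV 2 = 3
dUV (suc (suc (suc t))) = suc (dUV t)

dVV 0 = 0
dVV 1 = 3
dVV 2 = 4
dVV (suc (suc (suc t))) = suc (dVV t)

ladder : Layer → Layer → ℕ → ℕ
ladder U U = dUU
ladder U V = dUV
ladder V U = dUV
ladder V V = dVV

ladder-base : ∀ b → ladder b b 0 ≡ 0
ladder-base U = refl
ladder-base V = refl

dUU-suc : ∀ t → Within₁ (dUU t) (dUU (suc t))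
dUU-suc 0 = ≤-eval , ≤-eval
dUU-suc 1 = ≤-eval , ≤-eval
dUU-suc 2 = ≤-eval , ≤-eval
dUU-suc 3 = ≤-eval , ≤-eval
dUU-suc 4 = ≤-eval , ≤-eval
dUU-suc 5 = ≤-eval , ≤-eval
dUU-suc (suc (suc (suc t@(suc (suc (suc _)))))) = within₁-cong-suc (dUU-suc t)

dUV-suc : ∀ t → Within₁ (dUV t) (dUV (suc t))
dUV-suc 0 = ≤-eval , ≤-eval
dUV-suc 1 = ≤-eval , ≤-eval
dUV-suc 2 = ≤-eval , ≤-eval
dUV-suc (suc (suc (suc t))) = within₁-cong-suc (dUV-suc t)

dUU-dUV : ∀ t → Within₁ (dUU t) (dUV t)
dUU-dUV 0 = ≤-eval , ≤-eval
dUU-dUV 1 = ≤-eval , ≤-eval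
dUU-dUV 2 = ≤-eval , ≤-eval
dUU-dUV 3 = ≤-eval , ≤-eval
dUU-dUV 4 = ≤-eval , ≤-eval
dUU-dUV 5 = ≤-eval , ≤-eval
dUU-dUV (suc (suc (suc t@(suc (suc (suc _)))))) = within₁-cong-suc (dUU-dUV t)

dUV-dVV : ∀ t → Within₁ (dUV t) (dVV t)
dUV-dVV 0 = ≤-eval , ≤-eval
dUV-dVV 1 = ≤-eval , ≤-eval
dUV-dVV 2 = ≤-eval , ≤-eval
dUV-dVV (suc (suc (suc t))) = within₁-cong-suc (dUV-dVV t)

ladder-stride : ∀ a b t → Within₁ (ladder a b t) (ladder a b (stride a + t))
ladder-stride U U = dUU-suc
ladder-stride U V = dUV-suc
ladder-stride V U t = within₁-suc (dUV t)
ladder-stride V V t = within₁-suc (dVV t)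

ladder-spoke : ∀ a b t → Within₁ (ladder a b t) (ladder (other a) b t)
ladder-spoke U U = dUU-dUV
ladder-spoke U V = dUV-dVV
ladder-spoke V U t = within₁-sym (dUU-dUV t)
ladder-spoke V V t = within₁-sym (dUV-dVV t)

Descent : Layer → Layer → ℕ → Set
Descent a b t =
  (∃[ t′ ] t ≡ stride a + t′ × ladder a b t′ < ladder a b t) ⊎ ladder (other a) b t < ladder a b t

ladder-descent : ∀ a b t → ¬ (a ≡ b × t ≡ 0) → Descent a b t
ladder-descent U U 0 base = ⊥-elim (base (refl , refl))
ladder-descent U U 1 _ = inj₁ (0 , refl , ≤-eval)
ladder-descent U U 2 _ = inj₁ (1 , refl , ≤-eval)
ladder-descent U U (suc (suc (suc t))) _ = inj₂ (dUV<dUU t)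
  where
  dUV<dUU : ∀ t → dUV (3 + t) < dUU (3 + t)
  dUV<dUU 0 = ≤-eval
  dUV<dUU 1 = ≤-eval
  dUV<dUU 2 = ≤-eval
  dUV<dUU (suc (suc (suc t))) = s≤s (dUV<dUU t)
ladder-descent U V 0 _ = inj₂ ≤-eval
ladder-descent U V 1 _ = inj₁ (0 , refl , ≤-eval)
ladder-descent U V 2 _ = inj₁ (1 , refl , ≤-eval)
ladder-descent U V (suc (suc (suc t))) _ with ladder-descent U V t (λ { (() , _) })
... | inj₁ (t′ , refl , closer) = inj₁ (3 + t′ , refl , s≤s closer)
... | inj₂ closer = inj₂ (s≤s closer)
ladder-descent V U 0 _ = inj₂ ≤-eval
ladder-descent V U 1 _ = inj₂ ≤-eval
ladder-descent V U 2 _ = inj₂ ≤-eval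
ladder-descent V U (suc (suc (suc t))) _ = inj₁ (t , refl , ≤-refl)
ladder-descent V V 0 base = ⊥-elim (base (refl , refl))
ladder-descent V V 1 _ = inj₂ ≤-eval
ladder-descent V V 2 _ = inj₂ ≤-eval
ladder-descent V V (suc (suc (suc t))) _ = inj₁ (t , refl , ≤-refl)

ladderU[4+3m]≡ladderU[6+3m] : ∀ b m → ladder U b (4 + m * 3) ≡ ladder U b (6 + m * 3)
ladderU[4+3m]≡ladderU[6+3m] U zero = refl
ladderU[4+3m]≡ladderU[6+3m] U (suc m) = cong suc (ladderU[4+3m]≡ladderU[6+3m] U m)
ladderU[4+3m]≡ladderU[6+3m] V zero = refl
ladderU[4+3m]≡ladderU[6+3m] V (suc m) = cong suc (ladderU[4+3m]≡ladderU[6+3m] V m)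

ladderU[5+3m]≡ladderU[7+3m] : ∀ b m → ladder U b (5 + m * 3) ≡ ladder U b (7 + m * 3)
ladderU[5+3m]≡ladderU[7+3m] U zero = refl
ladderU[5+3m]≡ladderU[7+3m] U (suc m) = cong suc (ladderU[5+3m]≡ladderU[7+3m] U m)
ladderU[5+3m]≡ladderU[7+3m] V zero = refl
ladderU[5+3m]≡ladderU[7+3m] V (suc m) = cong suc (ladderU[5+3m]≡ladderU[7+3m] V m)

ladderV-wrap : ∀ b t → Within₁ (ladder V b 1 ⊓ ladder V b (9 + t)) (ladder V b 2 ⊓ ladder V b (8 + t))
ladderV-wrap b t =
  ⊓-within₁-first {ladder V b 1} {ladder V b (9 + t)} {ladder V b 2} {ladder V b (8 + t)}
    (near b) (far₁ b) (far₂ b)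
  where
  near : ∀ b → Within₁ (ladder V b 1) (ladder V b 2)
  near U = ≤-eval , ≤-eval
  near V = ≤-eval , ≤-eval
  far₁ : ∀ b → ladder V b 1 ≤ suc (ladder V b (8 + t))
  far₁ U = ≤-trans ≤-eval (m≤m+n 3 _)
  far₁ V = ≤-trans ≤-eval (m≤m+n 3 _)
  far₂ : ∀ b → ladder V b 2 ≤ suc (ladder V b (9 + t))
  far₂ U = ≤-trans ≤-eval (m≤m+n 4 _)
  far₂ V = ≤-trans ≤-eval (m≤m+n 4 _)

module Residues (n : ℕ) .{{_ : NonZero n}} where

  infix 4 _≋_
  record _≋_ (a b : ℕ) : Set where
    constructor mod-≡
    field %-≡ : a % n ≡ b % n
  open _≋_ public

  ≋-isEquivalence : IsEquivalence _≋_
  ≋-isEquivalence = record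
    { refl = mod-≡ refl
    ; sym = λ a≋b → mod-≡ (sym (%-≡ a≋b))
    ; trans = λ a≋b b≋c → mod-≡ (trans (%-≡ a≋b) (%-≡ b≋c))
    }

  ≋-setoid : Setoid _ _
  ≋-setoid = record { isEquivalence = ≋-isEquivalence }

  open IsEquivalence ≋-isEquivalence public using () renaming (refl to ≋-refl; sym to ≋-sym; trans to ≋-trans)
  module ≋-Reasoning = SetoidReasoning ≋-setoid

  ≋-reflexive : ∀ {a b} → a ≡ b → a ≋ b
  ≋-reflexive refl = ≋-refl

  %-≋ : ∀ a → a % n ≋ a
  %-≋ a = mod-≡ (m%n%n≡m%n a n)

  +n-≋ : ∀ a → a + n ≋ a
  +n-≋ a = mod-≡ ([m+n]%n≡m%n a n)

  ≋-+ : ∀ {a b c d} → a ≋ b → c ≋ d → a + c ≋ b + d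
  ≋-+ {a} {b} {c} {d} (mod-≡ a≡b) (mod-≡ c≡d) = mod-≡ (begin
    (a + c) % n             ≡⟨ %-distribˡ-+ a c n ⟩
    (a % n + c % n) % n     ≡⟨ cong₂ (λ x y → (x + y) % n) a≡b c≡d ⟩
    (b % n + d % n) % n     ≡⟨ %-distribˡ-+ b d n ⟨
    (b + d) % n             ∎)
    where open ≡-Reasoning

  ≋-*ˡ : ∀ c {a b} → a ≋ b → c * a ≋ c * b
  ≋-*ˡ c {a} {b} (mod-≡ a≡b) = mod-≡ (begin
    (c * a) % n             ≡⟨ %-distribˡ-* c a n ⟩
    (c % n * (a % n)) % n   ≡⟨ cong (λ x → (c % n * x) % n) a≡b ⟩
    (c % n * (b % n)) % n   ≡⟨ %-distribˡ-* c b n ⟨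
    (c * b) % n             ∎)
    where open ≡-Reasoning

  ≋⇒≡ : ∀ {a b} → a < n → b < n → a ≋ b → a ≡ b
  ≋⇒≡ {a} {b} a<n b<n (mod-≡ a≡b) = begin
    a       ≡⟨ m<n⇒m%n≡m a<n ⟨
    a % n   ≡⟨ a≡b ⟩
    b % n   ≡⟨ m<n⇒m%n≡m b<n ⟩
    b       ∎
    where open ≡-Reasoning

  %-residue : ∀ {x r} q → r < n → x ≡ r + q * n → x % n ≡ r
  %-residue {x} {r} q r<n x≡r+qn = trans (cong (_% n) x≡r+qn) (trans ([m+kn]%n≡m%n r q n) (m<n⇒m%n≡m r<n))

  %-wrap : ∀ {x r} → r < n → x ≡ r + n → x % n ≡ r
  %-wrap {x} {r} r<n x≡r+n = trans (cong (_% n) x≡r+n) (trans ([m+n]%n≡m%n r n) (m<n⇒m%n≡m r<n))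

  ≋-residue : ∀ {c x r} q → c < n → r < n → c ≋ x → x ≡ r + q * n → c ≡ r
  ≋-residue {c} q c<n r<n (mod-≡ c≡x) x≡r+qn =
    trans (sym (m<n⇒m%n≡m c<n)) (trans c≡x (%-residue q r<n x≡r+qn))

  +-cancelʳ-≋ : ∀ j {a b} → a + j ≋ b + j → a ≋ b
  +-cancelʳ-≋ j {a} {b} a+j≋b+j = begin
    a                        ≈⟨ undo a ⟨
    a + j + (n ∸ j % n)      ≈⟨ ≋-+ a+j≋b+j ≋-refl ⟩
    b + j + (n ∸ j % n)      ≈⟨ undo b ⟩
    b                        ∎
    where
    open ≋-Reasoning
    undo : ∀ x → x + j + (n ∸ j % n) ≋ x
    undo x = begin
      x + j + (n ∸ j % n)        ≈⟨ ≋-+ (≋-+ (≋-refl {x}) (%-≋ j)) ≋-refl ⟨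
      x + j % n + (n ∸ j % n)    ≡⟨ +-assoc x (j % n) _ ⟩
      x + (j % n + (n ∸ j % n))  ≡⟨ cong (x +_) (m+[n∸m]≡n (m%n≤n j n)) ⟩
      x + n                      ≈⟨ +n-≋ x ⟩
      x                          ∎

  -- the residue of i − j
  offset : ℕ → ℕ → ℕ
  offset i j = (i + (n ∸ j % n)) % n

  offset<n : ∀ i j → offset i j < n
  offset<n i j = m%n<n _ n

  offset-+ : ∀ i j → offset i j + j ≋ i
  offset-+ i j = begin
    (i + (n ∸ j % n)) % n + j    ≈⟨ ≋-+ (%-≋ (i + (n ∸ j % n))) (≋-sym (%-≋ j)) ⟩
    i + (n ∸ j % n) + j % n      ≡⟨ +-assoc i _ (j % n) ⟩
    i + ((n ∸ j % n) + j % n)    ≡⟨ cong (i +_) (m∸n+n≡m (m%n≤n j n)) ⟩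
    i + n                        ≈⟨ +n-≋ i ⟩
    i                            ∎
    where open ≋-Reasoning

  offset-unique : ∀ {i j c} → c < n → c + j ≋ i → offset i j ≡ c
  offset-unique {i} {j} c<n c+j≋i =
    ≋⇒≡ (offset<n i j) c<n (+-cancelʳ-≋ j (≋-trans (offset-+ i j) (≋-sym c+j≋i)))

  offset-self : ∀ i → offset i i ≡ 0
  offset-self i = offset-unique (>-nonZero⁻¹ n) ≋-refl

  offset-zero : ∀ {i j} → i < n → j < n → offset i j ≡ 0 → i ≡ j
  offset-zero {i} {j} i<n j<n offset≡0 =
    ≋⇒≡ i<n j<n (≋-trans (≋-sym (offset-+ i j)) (≋-reflexive (cong (_+ j) offset≡0)))

  offset-shift : ∀ i j s → offset ((i + s) % n) j ≡ (offset i j + s) % n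
  offset-shift i j s = offset-unique (m%n<n _ n) (begin
    (offset i j + s) % n + j   ≈⟨ ≋-+ (%-≋ (offset i j + s)) ≋-refl ⟩
    offset i j + s + j         ≡⟨ xy∙z≈xz∙y (offset i j) s j ⟩
    offset i j + j + s         ≈⟨ ≋-+ (offset-+ i j) ≋-refl ⟩
    i + s                      ≈⟨ %-≋ (i + s) ⟨
    (i + s) % n                ∎)
    where open ≋-Reasoning

_≟ᵥ_ : ∀ {n} → DecidableEquality (PVertex n)
u i ≟ᵥ u j = map′ (cong u) (λ { refl → refl }) (i ≟ᶠ j)
u i ≟ᵥ v j = no (λ ())
v i ≟ᵥ u j = no (λ ())
v i ≟ᵥ v j = map′ (cong v) (λ { refl → refl }) (i ≟ᶠ j)

module Potential (n : ℕ) .{{_ : NonZero n}} (w : PVertex n) (f : PVertex n → ℕ)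
  (f-target : f w ≡ 0)
  (f-lipschitz : ∀ {x y} → Adj n x y → f x ≤ suc (f y))
  (f-descent : ∀ x → x ≢ w → ∃[ y ] Adj n x y × f y < f x)
  where

  walk-length≥ : ∀ {x m} → Walk n x w m → f x ≤ m
  walk-length≥ here = ≤-reflexive f-target
  walk-length≥ (step x~y walk) = ≤-trans (f-lipschitz x~y) (s≤s (walk-length≥ walk))

  descending-walk : ∀ m x → f x ≡ m → Walk n x w m
  descending-walk m x fx≡m with x ≟ᵥ w
  ... | yes refl = subst (Walk n w w) (trans (sym f-target) fx≡m) here
  descending-walk zero x fx≡0 | no x≢w =
    let y , _ , fy<fx = f-descent x x≢w in ⊥-elim (n≮0 (subst (f y <_) fx≡0 fy<fx))
  descending-walk (suc m) x fx≡1+m | no x≢w =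
    let y , x~y , fy<fx = f-descent x x≢w
        fy≡m = ≤-antisym (≤-pred (subst (f y <_) fx≡1+m fy<fx))
                         (≤-pred (subst (_≤ suc (f y)) fx≡1+m (f-lipschitz x~y)))
    in step x~y (descending-walk m y fy≡m)

  potential-is-distance : ∀ {x d} → IsDist n x w d → d ≡ f x
  potential-is-distance {x} (walk , shortest) =
    ≤-antisym (shortest (f x) (descending-walk (f x) x refl)) (walk-length≥ walk)

module CycleDistance (n : ℕ) .{{_ : NonZero n}} (10≤n : 10 ≤ n) where

  open Residues n

  cycleDist : Layer → Layer → ℕ → ℕ
  cycleDist a b c = ladder a b c ⊓ ladder a b (n ∸ c)

  cycleDist-reflect : ∀ a b {c c′} → c + c′ ≡ n → cycleDist a b c ≡ cycleDist a b c′
  cycleDist-reflect a b {c} {c′} c+c′≡n = begin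
    ladder a b c ⊓ ladder a b (n ∸ c)     ≡⟨ cong (λ t → ladder a b c ⊓ ladder a b t) (+≡⇒∸≡ c+c′≡n) ⟩
    ladder a b c ⊓ ladder a b c′          ≡⟨ ⊓-comm (ladder a b c) (ladder a b c′) ⟩
    ladder a b c′ ⊓ ladder a b c          ≡⟨ cong (λ t → ladder a b c′ ⊓ ladder a b t) n∸c′≡c ⟨
    ladder a b c′ ⊓ ladder a b (n ∸ c′)   ∎
    where
    open ≡-Reasoning
    n∸c′≡c : n ∸ c′ ≡ c
    n∸c′≡c = +≡⇒∸≡ (trans (+-comm c′ c) c+c′≡n)

  cycleDist-% : ∀ a b {c} → c ≤ n → cycleDist a b (c % n) ≡ cycleDist a b c
  cycleDist-% a b c≤n with m≤n⇒m<n∨m≡n c≤n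
  ... | inj₁ c<n = cong (cycleDist a b) (m<n⇒m%n≡m c<n)
  ... | inj₂ refl = trans (cong (cycleDist a b) (n%n≡0 n)) (cycleDist-reflect a b refl)

  cycleDist-cong-ladder : ∀ a b {x y x′ y′} → x + y ≡ n → x′ + y′ ≡ n →
                          ladder a b x ≡ ladder a b x′ → ladder a b y ≡ ladder a b y′ →
                          cycleDist a b x ≡ cycleDist a b x′
  cycleDist-cong-ladder a b {x} {y} {x′} {y′} x+y≡n x′+y′≡n x≡x′ y≡y′ = cong₂ _⊓_ x≡x′ (begin
    ladder a b (n ∸ x)    ≡⟨ cong (ladder a b) (+≡⇒∸≡ {x} x+y≡n) ⟩
    ladder a b y          ≡⟨ y≡y′ ⟩
    ladder a b y′         ≡⟨ cong (ladder a b) (+≡⇒∸≡ {x′} x′+y′≡n) ⟨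
    ladder a b (n ∸ x′)   ∎)
    where open ≡-Reasoning

  cycleDist-spoke : ∀ a b c → Within₁ (cycleDist a b c) (cycleDist (other a) b c)
  cycleDist-spoke a b c = ⊓-within₁ (ladder-spoke a b c) (ladder-spoke a b (n ∸ c))

  cycleDist-stride : ∀ a b c → c + stride a ≤ n →
                     Within₁ (cycleDist a b c) (cycleDist a b ((c + stride a) % n))
  cycleDist-stride a b c c+s≤n with m≤n⇒∃[o]m+o≡n c+s≤n
  ... | r , c+s+r≡n = subst (Within₁ (cycleDist a b c)) (sym (cycleDist-% a b c+s≤n)) within
    where
    s = stride a
    n∸c≡s+r : n ∸ c ≡ s + r
    n∸c≡s+r = +≡⇒∸≡ {c} (trans (sym (+-assoc c s r)) c+s+r≡n)
    n∸[c+s]≡r : n ∸ (c + s) ≡ r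
    n∸[c+s]≡r = +≡⇒∸≡ c+s+r≡n
    within : Within₁ (ladder a b c ⊓ ladder a b (n ∸ c)) (ladder a b (c + s) ⊓ ladder a b (n ∸ (c + s)))
    within rewrite n∸c≡s+r | n∸[c+s]≡r | +-comm c s =
      ⊓-within₁ (ladder-stride a b c) (within₁-sym (ladder-stride a b r))

  cycleDist-wrap : ∀ b → Within₁ (cycleDist V b 1) (cycleDist V b 2)
  cycleDist-wrap b with m≤n⇒∃[o]m+o≡n 10≤n
  ... | t , 10+t≡n =
    subst (λ m → Within₁ (ladder V b 1 ⊓ ladder V b (m ∸ 1)) (ladder V b 2 ⊓ ladder V b (m ∸ 2)))
      10+t≡n (ladderV-wrap b t)

  cycleDist-edge : ∀ a b c → c < n → Within₁ (cycleDist a b c) (cycleDist a b ((c + stride a) % n))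
  cycleDist-edge U b c c<n = cycleDist-stride U b c (subst (_≤ n) (+-comm 1 c) c<n)
  cycleDist-edge V b c c<n with m≤n⇒∃[o]m+o≡n c<n
  ... | 0 , 1+c+0≡n =
    subst₂ Within₁ (cycleDist-reflect V b 1+c≡n) (cong (cycleDist V b) (sym c+3%n≡2)) (cycleDist-wrap b)
    where
    1+c≡n : 1 + c ≡ n
    1+c≡n = trans (sym (+-identityʳ (suc c))) 1+c+0≡n
    c+3%n≡2 : (c + 3) % n ≡ 2
    c+3%n≡2 = %-wrap (≤-trans ≤-eval 10≤n) (trans (+-comm c 3) (cong (2 +_) 1+c≡n))
  ... | 1 , 1+c+1≡n =
    subst₂ Within₁ (cycleDist-reflect V b 2+c≡n) (cong (cycleDist V b) (sym c+3%n≡1))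
      (within₁-sym (cycleDist-wrap b))
    where
    2+c≡n : 2 + c ≡ n
    2+c≡n = trans (+-comm 2 c) (trans (+-suc c 1) 1+c+1≡n)
    c+3%n≡1 : (c + 3) % n ≡ 1
    c+3%n≡1 = %-wrap (≤-trans ≤-eval 10≤n) (trans (+-comm c 3) (cong (1 +_) 2+c≡n))
  ... | suc (suc o) , 1+c+[2+o]≡n =
    cycleDist-stride V b c (subst (c + 3 ≤_) c+3+o≡n (m≤m+n (c + 3) o))
    where
    c+3+o≡n : c + 3 + o ≡ n
    c+3+o≡n = trans (+-assoc c 3 o) (trans (+-suc c (2 + o)) 1+c+[2+o]≡n)

  stride≤n : ∀ a → stride a ≤ n
  stride≤n U = ≤-trans ≤-eval 10≤n
  stride≤n V = ≤-trans ≤-eval 10≤n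

  CycleDescent : Layer → Layer → ℕ → Set
  CycleDescent a b c =
    cycleDist (other a) b c < cycleDist a b c ⊎
    cycleDist a b ((c + stride a) % n) < cycleDist a b c ⊎
    cycleDist a b ((c + (n ∸ stride a)) % n) < cycleDist a b c

  descent-near : ∀ a b c → c < n → ladder a b c ≤ ladder a b (n ∸ c) → Descent a b c →
                 CycleDescent a b c
  descent-near a b c c<n near (inj₂ across<) = inj₁ (⊓-glb across<′ (<-≤-trans across<′ near))
    where across<′ = ≤-<-trans (m⊓n≤m _ _) across<
  descent-near a b .(stride a + t) c<n near (inj₁ (t , refl , back<)) =
    inj₂ (inj₂ (⊓-glb back<′ (<-≤-trans back<′ near)))
    where
    s = stride a
    back≡t : (s + t + (n ∸ s)) % n ≡ t
    back≡t = %-wrap (≤-<-trans (m≤n+m t s) c<n) (begin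
      s + t + (n ∸ s)    ≡⟨ cong (_+ (n ∸ s)) (+-comm s t) ⟩
      t + s + (n ∸ s)    ≡⟨ +-assoc t s (n ∸ s) ⟩
      t + (s + (n ∸ s))  ≡⟨ cong (t +_) (m+[n∸m]≡n (stride≤n a)) ⟩
      t + n              ∎)
      where open ≡-Reasoning
    back<′ : cycleDist a b ((s + t + (n ∸ s)) % n) < ladder a b (s + t)
    back<′ = subst (λ d → cycleDist a b d < ladder a b (s + t)) (sym back≡t) (≤-<-trans (m⊓n≤m _ _) back<)

  descent-far : ∀ a b c → c < n → ladder a b (n ∸ c) < ladder a b c → Descent a b (n ∸ c) →
                CycleDescent a b c
  descent-far a b c c<n far (inj₂ across<) = inj₁ (⊓-glb (<-trans across<′ far) across<′)
    where across<′ = ≤-<-trans (m⊓n≤n _ _) across<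
  descent-far a b c c<n far (inj₁ (t , n∸c≡s+t , forth<)) =
    inj₂ (inj₁ (⊓-glb (<-trans forth<′ far) forth<′))
    where
    s = stride a
    c+s+t≡n : c + s + t ≡ n
    c+s+t≡n = trans (+-assoc c s t) (trans (cong (c +_) (sym n∸c≡s+t)) (m+[n∸m]≡n (<⇒≤ c<n)))
    c+s≤n : c + s ≤ n
    c+s≤n = subst (c + s ≤_) c+s+t≡n (m≤m+n (c + s) t)
    ladder[n∸[c+s]]≡ladder[t] : ladder a b (n ∸ (c + s)) ≡ ladder a b t
    ladder[n∸[c+s]]≡ladder[t] = cong (ladder a b) (+≡⇒∸≡ c+s+t≡n)
    forth<′ : cycleDist a b ((c + s) % n) < ladder a b (n ∸ c)
    forth<′ = subst (_< ladder a b (n ∸ c)) (sym (cycleDist-% a b c+s≤n))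
                (≤-<-trans (≤-trans (m⊓n≤n _ _) (≤-reflexive ladder[n∸[c+s]]≡ladder[t])) forth<)

  cycle-descent : ∀ a b c → c < n → ¬ (a ≡ b × c ≡ 0) → CycleDescent a b c
  cycle-descent a b c c<n not-base with ladder a b c ≤? ladder a b (n ∸ c)
  ... | yes near = descent-near a b c c<n near (ladder-descent a b c not-base)
  ... | no far = descent-far a b c c<n (≰⇒> far)
                   (ladder-descent a b (n ∸ c) (λ (_ , n∸c≡0) → <⇒≱ c<n (m∸n≡0⇒m≤n n∸c≡0)))

  pos : PVertex n → ℕ
  pos (u i) = toℕ i
  pos (v i) = toℕ i

  layer : PVertex n → Layer
  layer (u _) = U
  layer (v _) = V

  distance : PVertex n → PVertex n → ℕ
  distance x w = cycleDist (layer x) (layer w) (offset (pos x) (pos w))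

  distance-self : ∀ w → distance w w ≡ 0
  distance-self w rewrite offset-self (pos w) | ladder-base (layer w) = refl

  shift-within₁ : ∀ a w {i j} → j ≡ (i + stride a) % n →
                  Within₁ (cycleDist a (layer w) (offset i (pos w))) (cycleDist a (layer w) (offset j (pos w)))
  shift-within₁ a w {i} refl rewrite offset-shift i (pos w) (stride a) =
    cycleDist-edge a (layer w) (offset i (pos w)) (offset<n i (pos w))

  edge-within₁ : ∀ w {x y} → PEdge n x y → Within₁ (distance x w) (distance y w)
  edge-within₁ w (outer i j j≡i+1) = shift-within₁ U w j≡i+1
  edge-within₁ w (spoke i) = cycleDist-spoke U (layer w) (offset (toℕ i) (pos w))
  edge-within₁ w (inner i j j≡i+3) = shift-within₁ V w j≡i+3

  adj-lipschitz : ∀ w {x y} → Adj n x y → distance x w ≤ suc (distance y w)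
  adj-lipschitz w (inj₁ x→y) = proj₁ (edge-within₁ w x→y)
  adj-lipschitz w (inj₂ y→x) = proj₂ (edge-within₁ w y→x)

  _⊕_ : Fin n → ℕ → Fin n
  i ⊕ s = fromℕ< (m%n<n (toℕ i + s) n)

  toℕ-⊕ : ∀ i s → toℕ (i ⊕ s) ≡ (toℕ i + s) % n
  toℕ-⊕ i s = toℕ-fromℕ< (m%n<n (toℕ i + s) n)

  ⊕-back : ∀ a i → toℕ i ≡ (toℕ (i ⊕ (n ∸ stride a)) + stride a) % n
  ⊕-back a i = sym (trans (%-≡ back≋i) (m<n⇒m%n≡m (toℕ<n i)))
    where
    open ≋-Reasoning
    s = stride a
    back≋i : toℕ (i ⊕ (n ∸ s)) + s ≋ toℕ i
    back≋i = begin
      toℕ (i ⊕ (n ∸ s)) + s        ≡⟨ cong (_+ s) (toℕ-⊕ i (n ∸ s)) ⟩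
      (toℕ i + (n ∸ s)) % n + s    ≈⟨ ≋-+ (%-≋ (toℕ i + (n ∸ s))) ≋-refl ⟩
      toℕ i + (n ∸ s) + s          ≡⟨ +-assoc (toℕ i) (n ∸ s) s ⟩
      toℕ i + ((n ∸ s) + s)        ≡⟨ cong (toℕ i +_) (m∸n+n≡m (stride≤n a)) ⟩
      toℕ i + n                    ≈⟨ +n-≋ (toℕ i) ⟩
      toℕ i                        ∎

  across : PVertex n → PVertex n
  across (u i) = v i
  across (v i) = u i

  move : PVertex n → ℕ → PVertex n
  move (u i) s = u (i ⊕ s)
  move (v i) s = v (i ⊕ s)

  adj-across : ∀ x → Adj n x (across x)
  adj-across (u i) = inj₁ (spoke i)
  adj-across (v i) = inj₂ (spoke i)

  adj-forward : ∀ x → Adj n x (move x (stride (layer x)))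
  adj-forward (u i) = inj₁ (outer i (i ⊕ 1) (toℕ-⊕ i 1))
  adj-forward (v i) = inj₁ (inner i (i ⊕ 3) (toℕ-⊕ i 3))

  adj-backward : ∀ x → Adj n x (move x (n ∸ stride (layer x)))
  adj-backward (u i) = inj₂ (outer (i ⊕ (n ∸ 1)) i (⊕-back U i))
  adj-backward (v i) = inj₂ (inner (i ⊕ (n ∸ 3)) i (⊕-back V i))

  distance-across : ∀ x w → distance (across x) w ≡ cycleDist (other (layer x)) (layer w) (offset (pos x) (pos w))
  distance-across (u i) w = refl
  distance-across (v i) w = refl

  pos-move : ∀ x s → pos (move x s) ≡ (pos x + s) % n
  pos-move (u i) = toℕ-⊕ i
  pos-move (v i) = toℕ-⊕ i

  offset-move : ∀ x w s → offset (pos (move x s)) (pos w) ≡ (offset (pos x) (pos w) + s) % n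
  offset-move x w s = trans (cong (λ p → offset p (pos w)) (pos-move x s)) (offset-shift (pos x) (pos w) s)

  distance-move : ∀ x w s →
                  distance (move x s) w ≡ cycleDist (layer x) (layer w) ((offset (pos x) (pos w) + s) % n)
  distance-move (u i) w s = cong (cycleDist U (layer w)) (offset-move (u i) w s)
  distance-move (v i) w s = cong (cycleDist V (layer w)) (offset-move (v i) w s)

  same-layer-offset-0 : ∀ x w → layer x ≡ layer w × offset (pos x) (pos w) ≡ 0 → x ≡ w
  same-layer-offset-0 (u i) (u j) (_ , offset≡0) =
    cong u (toℕ-injective (offset-zero (toℕ<n i) (toℕ<n j) offset≡0))
  same-layer-offset-0 (v i) (v j) (_ , offset≡0) =
    cong v (toℕ-injective (offset-zero (toℕ<n i) (toℕ<n j) offset≡0))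
  same-layer-offset-0 (u i) (v j) (() , _)
  same-layer-offset-0 (v i) (u j) (() , _)

  descent : ∀ w x → x ≢ w → ∃[ y ] Adj n x y × distance y w < distance x w
  descent w x x≢w with cycle-descent (layer x) (layer w) (offset (pos x) (pos w)) (offset<n (pos x) (pos w))
                                     (λ base → x≢w (same-layer-offset-0 x w base))
  ... | inj₁ across< = across x , adj-across x , subst (_< distance x w) (sym (distance-across x w)) across<
  ... | inj₂ (inj₁ forth<) = move x _ , adj-forward x , subst (_< distance x w) (sym (distance-move x w _)) forth<
  ... | inj₂ (inj₂ back<) = move x _ , adj-backward x , subst (_< distance x w) (sym (distance-move x w _)) back<

  distance-formula : ∀ {x w d} → IsDist n x w d → d ≡ distance x w
  distance-formula {w = w} =
    Potential.potential-is-distance n w (λ x → distance x w) (distance-self w) (adj-lipschitz w) (descent w)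

module Translates (k : ℕ) (6≤k : 6 ≤ k) where

  open Residues (2 + 6 * k)

  -- δ ∈ Good makes u_i and u_{i+2} equidistant from w = u_j or v_j whenever i − j ≡ 3k + 3δ
  -- (good⇒unresolved)
  data Good (δ : ℕ) : Set where
    at-0 : δ ≡ 0 → Good δ
    lower : k + 1 < δ → δ < 3 * k → Good δ
    at-3k+1 : δ ≡ 3 * k + 1 → Good δ
    upper : 3 * k + 3 ≤ δ → δ ≤ 5 * k → Good δ

  data Gap (t : ℕ) : Set where
    low : 0 < t → t ≤ k + 1 → Gap t
    at-3k : t ≡ 3 * k → Gap t
    at-3k+2 : t ≡ 3 * k + 2 → Gap t

  good-or-gap : ∀ t → t ≤ 5 * k → Good t ⊎ Gap t
  good-or-gap zero _ = inj₁ (at-0 refl)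
  good-or-gap (suc t) 1+t≤5k with suc t ≤? k + 1
  ... | yes 1+t≤k+1 = inj₂ (low z<s 1+t≤k+1)
  ... | no 1+t≰k+1 with compare-near (suc t) (3 * k)
  ...   | inj₁ 1+t<3k = inj₁ (lower (≰⇒> 1+t≰k+1) 1+t<3k)
  ...   | inj₂ (inj₁ 1+t≡3k) = inj₂ (at-3k 1+t≡3k)
  ...   | inj₂ (inj₂ (inj₁ 1+t≡3k+1)) = inj₁ (at-3k+1 1+t≡3k+1)
  ...   | inj₂ (inj₂ (inj₂ (inj₁ 1+t≡3k+2))) = inj₂ (at-3k+2 1+t≡3k+2)
  ...   | inj₂ (inj₂ (inj₂ (inj₂ 3k+3≤1+t))) = inj₁ (upper 3k+3≤1+t 1+t≤5k)

  good-k+2 : Good (k + 2)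
  good-k+2 = lower (≤-reflexive (sym (+-suc k 1))) (≤-by-certificate (k + 3) 6≤k (solve (k ∷ [])))

  good-k+3 : Good (k + 3)
  good-k+3 = lower (≤-by-slack 1 (solve (k ∷ []))) (≤-by-certificate (k + 2) 6≤k (solve (k ∷ [])))

  gap-shift : ∀ {t} → Gap t → Good (k + 2 + t) × Good (k + 3 + t)
  gap-shift {t} (low _ t≤k+1) =
    lower (≤-by-slack t (solve (k ∷ t ∷ [])))
          (≤-by-certificate 2 (+-mono-≤ 6≤k t≤k+1) (solve (k ∷ t ∷ []))) ,
    lower (≤-by-slack (suc t) (solve (k ∷ t ∷ [])))
          (≤-by-certificate 1 (+-mono-≤ 6≤k t≤k+1) (solve (k ∷ t ∷ [])))
  gap-shift (at-3k refl) =
    upper (≤-by-certificate 5 6≤k (solve (k ∷ []))) (≤-by-certificate 4 6≤k (solve (k ∷ []))) ,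
    upper (≤-by-certificate 6 6≤k (solve (k ∷ []))) (≤-by-certificate 3 6≤k (solve (k ∷ [])))
  gap-shift (at-3k+2 refl) =
    upper (≤-by-certificate 7 6≤k (solve (k ∷ []))) (≤-by-certificate 2 6≤k (solve (k ∷ []))) ,
    upper (≤-by-certificate 8 6≤k (solve (k ∷ []))) (≤-by-certificate 1 6≤k (solve (k ∷ [])))

  good-shift : ∀ t → t + 2 ≤ 4 * k → Good (k + 2 + t) ⊎ Good (k + 3 + t)
  good-shift t t+2≤4k = place (compare-near (k + 2 + t) (3 * k))
    where
    k+3+t≡ : k + 3 + t ≡ suc (k + 2 + t)
    k+3+t≡ = cong (_+ t) (+-suc k 2)
    place : let m = k + 2 + t in m < 3 * k ⊎ m ≡ 3 * k ⊎ m ≡ 3 * k + 1 ⊎ m ≡ 3 * k + 2 ⊎ 3 * k + 3 ≤ m →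
            Good (k + 2 + t) ⊎ Good (k + 3 + t)
    place (inj₁ <3k) = inj₁ (lower (≤-by-slack t (solve (k ∷ t ∷ []))) <3k)
    place (inj₂ (inj₁ ≡3k)) = inj₂ (subst Good (sym k+3+t≡) (at-3k+1 (trans (cong suc ≡3k) (+-comm 1 (3 * k)))))
    place (inj₂ (inj₂ (inj₁ ≡3k+1))) = inj₁ (at-3k+1 ≡3k+1)
    place (inj₂ (inj₂ (inj₂ (inj₁ ≡3k+2)))) =
      inj₂ (subst Good (sym k+3+t≡)
        (upper (≤-reflexive (trans (+-suc (3 * k) 2) (cong suc (sym ≡3k+2))))
               (subst (λ m → suc m ≤ 5 * k) (sym ≡3k+2) (≤-by-certificate (k + 3) 6≤k (solve (k ∷ []))))))
    place (inj₂ (inj₂ (inj₂ (inj₂ ≥3k+3)))) =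
      inj₁ (upper ≥3k+3 (≤-by-certificate 0 t+2≤4k (solve (k ∷ t ∷ []))))

  pick-shift : ∀ {t t′} → Good (k + 2 + t) × Good (k + 3 + t) → Good (k + 2 + t′) ⊎ Good (k + 3 + t′) →
                   ∃[ x ] Good x × Good (x + t) × Good (x + t′)
  pick-shift (good₂ , _) (inj₁ good₂′) = k + 2 , good-k+2 , good₂ , good₂′
  pick-shift (_ , good₃) (inj₂ good₃′) = k + 3 , good-k+3 , good₃ , good₃′

  good-triple : ∀ A B → B ≤ A → A + B ≤ 2 + 6 * k → 2 * A ≤ 2 + 6 * k + B →
                     ∃[ x ] Good x × Good (x + A) × Good (x + B)
  good-triple A B B≤A A+B≤n 2A≤n+B = choose (good-or-gap A A≤5k) (good-or-gap B B≤5k)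
    where
    A≤5k : A ≤ 5 * k
    A≤5k = *-cancelˡ-≤ 3 (≤-by-certificate (2 * k + 2) (+-mono-≤ (+-mono-≤ A+B≤n 2A≤n+B) 6≤k)
                                              (solve (k ∷ A ∷ B ∷ [])))
    B+2≤4k : B + 2 ≤ 4 * k
    B+2≤4k = *-cancelˡ-≤ 2 (≤-by-certificate k (+-mono-≤ (+-mono-≤ B≤A A+B≤n) 6≤k)
                                              (solve (k ∷ A ∷ B ∷ [])))
    B≤5k : B ≤ 5 * k
    B≤5k = ≤-by-certificate (k + 2) B+2≤4k (solve (k ∷ B ∷ []))
    -- for k = 6 this bound holds only after rounding 2A ≤ 7k + 3 down
    A+2≤4k : Gap B → A + 2 ≤ 4 * k
    A+2≤4k (low _ B≤k+1) = ≮⇒≥ λ (4k<A+2 : 4 * k < A + 2) →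
      ⊥-by-certificate 0 (+-mono-≤ (+-mono-≤ (+-mono-≤ (+-mono-≤ 4k<A+2 4k<A+2) 2A≤n+B) B≤k+1) 6≤k)
                         (solve (k ∷ A ∷ B ∷ []))
    A+2≤4k (at-3k refl) = ≤-by-certificate 2 (+-mono-≤ A+B≤n 6≤k) (solve (k ∷ A ∷ []))
    A+2≤4k (at-3k+2 refl) = ≤-by-certificate 4 (+-mono-≤ A+B≤n 6≤k) (solve (k ∷ A ∷ []))
    choose : Good A ⊎ Gap A → Good B ⊎ Gap B → ∃[ x ] Good x × Good (x + A) × Good (x + B)
    choose (inj₁ good-A) (inj₁ good-B) = 0 , at-0 refl , good-A , good-B
    choose (inj₂ gap-A) _ = pick-shift (gap-shift gap-A) (good-shift B B+2≤4k)
    choose (inj₁ _) (inj₂ gap-B) =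
      let x , good-x , good-x+B , good-x+A = pick-shift (gap-shift gap-B) (good-shift A (A+2≤4k gap-B))
      in x , good-x , good-x+A , good-x+B

  infix 4 _∈_+Good
  _∈_+Good : ℕ → ℕ → Set
  x ∈ y +Good = ∃[ δ ] Good δ × x ≋ δ + y

  CommonPoint : ℕ → ℕ → ℕ → Set
  CommonPoint y₁ y₂ y₃ = ∃[ x ] x ∈ y₁ +Good × x ∈ y₂ +Good × x ∈ y₃ +Good

  common-around : ∀ {z₀ z₁ z₂} G g₁ g₂ → G + g₁ + g₂ ≡ 2 + 6 * k → g₁ ≤ G → g₂ ≤ G →
                  G + z₀ ≋ z₁ → g₁ + z₁ ≋ z₂ → CommonPoint z₀ z₁ z₂
  common-around {z₀} {z₁} {z₂} G g₁ g₂ G+g₁+g₂≡n g₁≤G g₂≤G G+z₀≋z₁ g₁+z₁≋z₂ =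
    let x , good-x , good-x+A , good-x+B = good-triple (g₁ + g₂) g₂ (m≤n+m g₂ g₁) A+B≤n 2A≤n+B
    in x + z₀ , (x , good-x , ≋-refl) , (x + (g₁ + g₂) , good-x+A , ≋-sym (back₁ x))
                                    , (x + g₂ , good-x+B , ≋-sym (back₂ x))
    where
    open ≋-Reasoning
    A+B≤n : g₁ + g₂ + g₂ ≤ 2 + 6 * k
    A+B≤n = subst (g₁ + g₂ + g₂ ≤_) G+g₁+g₂≡n
              (≤-by-certificate 0 g₂≤G (solve (G ∷ g₁ ∷ g₂ ∷ [])))
    2A≤n+B : 2 * (g₁ + g₂) ≤ 2 + 6 * k + g₂
    2A≤n+B = subst (λ m → 2 * (g₁ + g₂) ≤ m + g₂) G+g₁+g₂≡n
                   (≤-by-certificate 0 g₁≤G (solve (G ∷ g₁ ∷ g₂ ∷ [])))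
    back₁ : ∀ x → x + (g₁ + g₂) + z₁ ≋ x + z₀
    back₁ x = begin
      x + (g₁ + g₂) + z₁          ≈⟨ ≋-+ ≋-refl G+z₀≋z₁ ⟨
      x + (g₁ + g₂) + (G + z₀)    ≡⟨ solve (x ∷ g₁ ∷ g₂ ∷ z₀ ∷ G ∷ []) ⟩
      x + z₀ + (G + g₁ + g₂)      ≡⟨ cong (x + z₀ +_) G+g₁+g₂≡n ⟩
      x + z₀ + (2 + 6 * k)        ≈⟨ +n-≋ (x + z₀) ⟩
      x + z₀                      ∎
    back₂ : ∀ x → x + g₂ + z₂ ≋ x + z₀
    back₂ x = begin
      x + g₂ + z₂                 ≈⟨ ≋-+ ≋-refl g₁+z₁≋z₂ ⟨
      x + g₂ + (g₁ + z₁)          ≈⟨ ≋-+ (≋-refl {x + g₂}) (≋-+ (≋-refl {g₁}) G+z₀≋z₁) ⟨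
      x + g₂ + (g₁ + (G + z₀))    ≡⟨ solve (x ∷ g₁ ∷ g₂ ∷ z₀ ∷ G ∷ []) ⟩
      x + z₀ + (G + g₁ + g₂)      ≡⟨ cong (x + z₀ +_) G+g₁+g₂≡n ⟩
      x + z₀ + (2 + 6 * k)        ≈⟨ +n-≋ (x + z₀) ⟩
      x + z₀                      ∎

  rotate : ∀ {y₁ y₂ y₃} → CommonPoint y₁ y₂ y₃ → CommonPoint y₂ y₃ y₁
  rotate (x , in₁ , in₂ , in₃) = x , in₂ , in₃ , in₁

  swap₂₃ : ∀ {y₁ y₂ y₃} → CommonPoint y₁ y₂ y₃ → CommonPoint y₁ y₃ y₂
  swap₂₃ (x , in₁ , in₂ , in₃) = x , in₁ , in₃ , in₂

  common-gaps : ∀ {y₁ y₂ y₃} a b c → a + b + c ≡ 2 + 6 * k →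
                a + y₁ ≋ y₂ → b + y₂ ≋ y₃ → c + y₃ ≋ y₁ → CommonPoint y₁ y₂ y₃
  common-gaps a b c a+b+c≡n a+y₁≋y₂ b+y₂≋y₃ c+y₃≋y₁ with largest-of-three a b c
  ... | inj₁ (b≤a , c≤a) = common-around a b c a+b+c≡n b≤a c≤a a+y₁≋y₂ b+y₂≋y₃
  ... | inj₂ (inj₁ (c≤b , a≤b)) =
    rotate (rotate (common-around b c a (trans (+-rotate a b c) a+b+c≡n) c≤b a≤b b+y₂≋y₃ c+y₃≋y₁))
  ... | inj₂ (inj₂ (a≤c , b≤c)) =
    rotate (common-around c a b (trans (trans (+-rotate b c a) (+-rotate a b c)) a+b+c≡n)
                          a≤c b≤c c+y₃≋y₁ a+y₁≋y₂)

  common-ordered : ∀ y₁ y₂ y₃ → offset y₂ y₁ ≤ offset y₃ y₁ → CommonPoint y₁ y₂ y₃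
  common-ordered y₁ y₂ y₃ a≤q =
    let b , a+b≡q = m≤n⇒∃[o]m+o≡n a≤q
        c , q+c≡n = m≤n⇒∃[o]m+o≡n (<⇒≤ (offset<n y₃ y₁))
    in common-gaps a b c (trans (cong (_+ c) a+b≡q) q+c≡n)
                   (offset-+ y₂ y₁) (b+y₂≋y₃ a+b≡q) (c+y₃≋y₁ q+c≡n)
    where
    open ≋-Reasoning
    a = offset y₂ y₁
    q = offset y₃ y₁
    b+y₂≋y₃ : ∀ {b} → a + b ≡ q → b + y₂ ≋ y₃
    b+y₂≋y₃ {b} a+b≡q = begin
      b + y₂           ≈⟨ ≋-+ (≋-refl {b}) (offset-+ y₂ y₁) ⟨
      b + (a + y₁)     ≡⟨ +-assoc b a y₁ ⟨
      b + a + y₁       ≡⟨ cong (_+ y₁) (trans (+-comm b a) a+b≡q) ⟩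
      q + y₁           ≈⟨ offset-+ y₃ y₁ ⟩
      y₃               ∎
    c+y₃≋y₁ : ∀ {c} → q + c ≡ 2 + 6 * k → c + y₃ ≋ y₁
    c+y₃≋y₁ {c} q+c≡n = begin
      c + y₃             ≈⟨ ≋-+ (≋-refl {c}) (offset-+ y₃ y₁) ⟨
      c + (q + y₁)       ≡⟨ +-assoc c q y₁ ⟨
      c + q + y₁         ≡⟨ cong (_+ y₁) (trans (+-comm c q) q+c≡n) ⟩
      2 + 6 * k + y₁     ≡⟨ +-comm (2 + 6 * k) y₁ ⟩
      y₁ + (2 + 6 * k)   ≈⟨ +n-≋ y₁ ⟩
      y₁                 ∎

  common : ∀ y₁ y₂ y₃ → CommonPoint y₁ y₂ y₃
  common y₁ y₂ y₃ with ≤-total (offset y₂ y₁) (offset y₃ y₁)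
  ... | inj₁ p≤q = common-ordered y₁ y₂ y₃ p≤q
  ... | inj₂ q≤p = swap₂₃ (common-ordered y₁ y₃ y₂ q≤p)

  common-family : ∀ {m} → m ≤ 3 → (y : Fin m → ℕ) → ∃[ x ] ∀ l → x ∈ y l +Good
  common-family {0} _ _ = 0 , λ ()
  common-family {1} _ y =
    let x , in₀ , _ = common (y fzero) (y fzero) (y fzero) in x , λ { fzero → in₀ }
  common-family {2} _ y =
    let x , in₀ , in₁ , _ = common (y fzero) (y (fsuc fzero)) (y (fsuc fzero))
    in x , λ { fzero → in₀ ; (fsuc fzero) → in₁ }
  common-family {3} _ y =
    let x , in₀ , in₁ , in₂ = common (y fzero) (y (fsuc fzero)) (y (fsuc (fsuc fzero)))
    in x , λ { fzero → in₀ ; (fsuc fzero) → in₁ ; (fsuc (fsuc fzero)) → in₂ }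
  common-family {suc (suc (suc (suc _)))} (s≤s (s≤s (s≤s ()))) _

module UnresolvedPairs (k : ℕ) (6≤k : 6 ≤ k) where

  10≤n : 10 ≤ 2 + 6 * k
  10≤n = ≤-trans ≤-eval (+-monoʳ-≤ 2 (*-monoʳ-≤ 6 6≤k))

  open Residues (2 + 6 * k)
  open CycleDistance (2 + 6 * k) 10≤n public
  open Translates k 6≤k public

  Unresolved : Layer → ℕ → Set
  Unresolved b c = cycleDist U b c ≡ cycleDist U b ((c + 2) % (2 + 6 * k))

  unresolved-at : ∀ b {c r r′} → c ≡ r → (c + 2) % (2 + 6 * k) ≡ r′ →
                  cycleDist U b r ≡ cycleDist U b r′ → Unresolved b c
  unresolved-at b refl refl r≡r′ = r≡r′

  unresolved-at-0 : ∀ b {c} → c < 2 + 6 * k → c ≋ 3 * k + 3 * 0 → Unresolved b c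
  unresolved-at-0 b {c} c<n c≋ = unresolved-at b c≡3k c+2%n≡3k+2 (cycleDist-reflect U b (solve (k ∷ [])))
    where
    3k+2<n : 3 * k + 2 < 2 + 6 * k
    3k+2<n = ≤-by-certificate (2 * k + 5) 6≤k (solve (k ∷ []))
    c≡3k : c ≡ 3 * k
    c≡3k = ≋-residue 0 c<n (≤-<-trans (m≤m+n (3 * k) 2) 3k+2<n) c≋ (solve (k ∷ []))
    c+2%n≡3k+2 : (c + 2) % (2 + 6 * k) ≡ 3 * k + 2
    c+2%n≡3k+2 = %-residue 0 3k+2<n (trans (cong (_+ 2) c≡3k) (sym (+-identityʳ (3 * k + 2))))

  unresolved-at-3k+1 : ∀ b {c} → c < 2 + 6 * k → c ≋ 3 * k + 3 * (3 * k + 1) → Unresolved b c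
  unresolved-at-3k+1 b {c} c<n c≋ = unresolved-at b c≡1+6k c+2%n≡1 (cycleDist-reflect U b (+-comm (1 + 6 * k) 1))
    where
    c≡1+6k : c ≡ 1 + 6 * k
    c≡1+6k = ≋-residue 1 c<n ≤-refl c≋ (solve (k ∷ []))
    c+2%n≡1 : (c + 2) % (2 + 6 * k) ≡ 1
    c+2%n≡1 = %-wrap (s≤s (s≤s z≤n)) (trans (cong (_+ 2) c≡1+6k) (solve (k ∷ [])))

  unresolved-lower : ∀ b {e f c} → suc (suc (k + 1) + e) + f ≡ 3 * k → c < 2 + 6 * k →
                     c ≋ 3 * k + 3 * (suc (k + 1) + e) → Unresolved b c
  unresolved-lower b {e} {f} {c} 1+δ+f≡3k c<n c≋ =
    unresolved-at b c≡4+3e c+2%n≡6+3e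
      (cycleDist-cong-ladder U b split split′ (ladderU[4+3m]≡ladderU[6+3m] b e)
                                              (sym (ladderU[5+3m]≡ladderU[7+3m] b f)))
    where
    split : 4 + e * 3 + (7 + f * 3) ≡ 2 + 6 * k
    split = ≡-by-certificate (cong (3 *_) (sym 1+δ+f≡3k)) (solve (k ∷ e ∷ f ∷ []))
    split′ : 6 + e * 3 + (5 + f * 3) ≡ 2 + 6 * k
    split′ = begin
      6 + e * 3 + (5 + f * 3)   ≡⟨ solve (e ∷ f ∷ []) ⟩
      4 + e * 3 + (7 + f * 3)   ≡⟨ split ⟩
      2 + 6 * k                 ∎
      where open ≡-Reasoning
    c≡4+3e : c ≡ 4 + e * 3
    c≡4+3e = ≋-residue 1 c<n (<-of-sum split) c≋ (solve (k ∷ e ∷ []))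
    c+2%n≡6+3e : (c + 2) % (2 + 6 * k) ≡ 6 + e * 3
    c+2%n≡6+3e = %-residue 0 (<-of-sum split′) (trans (cong (_+ 2) c≡4+3e) (solve (e ∷ [])))

  unresolved-upper : ∀ b {e f c} → 3 * k + 3 + e + f ≡ 5 * k → c < 2 + 6 * k →
                     c ≋ 3 * k + 3 * (3 * k + 3 + e) → Unresolved b c
  unresolved-upper b {e} {f} {c} δ+f≡5k c<n c≋ =
    unresolved-at b c≡5+3e c+2%n≡7+3e
      (cycleDist-cong-ladder U b split split′ (ladderU[5+3m]≡ladderU[7+3m] b e)
                                              (sym (ladderU[4+3m]≡ladderU[6+3m] b f)))
    where
    split : 5 + e * 3 + (6 + f * 3) ≡ 2 + 6 * k
    split = ≡-by-certificate (cong (3 *_) (sym δ+f≡5k)) (solve (k ∷ e ∷ f ∷ []))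
    split′ : 7 + e * 3 + (4 + f * 3) ≡ 2 + 6 * k
    split′ = begin
      7 + e * 3 + (4 + f * 3)   ≡⟨ solve (e ∷ f ∷ []) ⟩
      5 + e * 3 + (6 + f * 3)   ≡⟨ split ⟩
      2 + 6 * k                 ∎
      where open ≡-Reasoning
    c≡5+3e : c ≡ 5 + e * 3
    c≡5+3e = ≋-residue 2 c<n (<-of-sum split) c≋ (solve (k ∷ e ∷ []))
    c+2%n≡7+3e : (c + 2) % (2 + 6 * k) ≡ 7 + e * 3
    c+2%n≡7+3e = %-residue 0 (<-of-sum split′) (trans (cong (_+ 2) c≡5+3e) (solve (e ∷ [])))

  good⇒unresolved : ∀ b {δ c} → Good δ → c < 2 + 6 * k → c ≋ 3 * k + 3 * δ → Unresolved b c
  good⇒unresolved b (at-0 refl) = unresolved-at-0 b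
  good⇒unresolved b (at-3k+1 refl) = unresolved-at-3k+1 b
  good⇒unresolved b (lower k+1<δ δ<3k) with m≤n⇒∃[o]m+o≡n k+1<δ | m≤n⇒∃[o]m+o≡n δ<3k
  ... | _ , refl | _ , 1+δ+f≡3k = unresolved-lower b 1+δ+f≡3k
  good⇒unresolved b (upper 3k+3≤δ δ≤5k) with m≤n⇒∃[o]m+o≡n 3k+3≤δ | m≤n⇒∃[o]m+o≡n δ≤5k
  ... | _ , refl | _ , δ+f≡5k = unresolved-upper b δ+f≡5k

  -- 3 (2k + 1) = n + 1
  third : ℕ → ℕ
  third j = (2 * k + 1) * j

  3*third≋ : ∀ j → 3 * third j ≋ j
  3*third≋ j = begin
    3 * ((2 * k + 1) * j)    ≡⟨ solve (k ∷ j ∷ []) ⟩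
    j + j * (2 + 6 * k)      ≈⟨ mod-≡ ([m+kn]%n≡m%n j j (2 + 6 * k)) ⟩
    j                        ∎
    where open ≋-Reasoning

  anchor : PVertex (2 + 6 * k) → ℕ
  anchor w = third (pos w + 3 * k)

  index : ℕ → Fin (2 + 6 * k)
  index x = fromℕ< (m%n<n (3 * x) (2 + 6 * k))

  unresolved : ∀ x w → x ∈ anchor w +Good → distance (u (index x)) w ≡ distance (u (index x ⊕ 2)) w
  unresolved x w (δ , good , x≋δ+y) =
    trans (good⇒unresolved (layer w) good (offset<n (toℕ (index x)) (pos w)) offset≋)
          (sym (distance-move (u (index x)) w 2))
    where
    open ≋-Reasoning
    rearrange : ∀ a b c → a + (b + c) ≡ c + a + b
    rearrange a b c = solve (a ∷ b ∷ c ∷ [])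
    offset≋ : offset (toℕ (index x)) (pos w) ≋ 3 * k + 3 * δ
    offset≋ = +-cancelʳ-≋ (pos w) (begin
      offset (toℕ (index x)) (pos w) + pos w      ≈⟨ offset-+ (toℕ (index x)) (pos w) ⟩
      toℕ (index x)                               ≡⟨ toℕ-fromℕ< _ ⟩
      (3 * x) % (2 + 6 * k)                       ≈⟨ %-≋ (3 * x) ⟩
      3 * x                                       ≈⟨ ≋-*ˡ 3 x≋δ+y ⟩
      3 * (δ + anchor w)                          ≡⟨ *-distribˡ-+ 3 δ (anchor w) ⟩
      3 * δ + 3 * anchor w                        ≈⟨ ≋-+ (≋-refl {3 * δ}) (3*third≋ (pos w + 3 * k)) ⟩
      3 * δ + (pos w + 3 * k)                     ≡⟨ rearrange (3 * δ) (pos w) (3 * k) ⟩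
      3 * k + 3 * δ + pos w                       ∎)

  u≢u⊕2 : ∀ i → u i ≢ u (i ⊕ 2)
  u≢u⊕2 i ui≡ui⊕2 =
    2≢0 (≋⇒≡ (≤-trans ≤-eval 10≤n) (≤-trans ≤-eval 10≤n) (+-cancelʳ-≋ (toℕ i) 2+i≋i))
    where
    open ≋-Reasoning
    2≢0 : 2 ≢ 0
    2≢0 ()
    2+i≋i : 2 + toℕ i ≋ toℕ i
    2+i≋i = begin
      2 + toℕ i                 ≡⟨ +-comm 2 (toℕ i) ⟩
      toℕ i + 2                 ≈⟨ %-≋ (toℕ i + 2) ⟨
      (toℕ i + 2) % (2 + 6 * k) ≡⟨ toℕ-⊕ i 2 ⟨
      toℕ (i ⊕ 2)               ≡⟨ cong pos ui≡ui⊕2 ⟨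
      toℕ i                     ∎

theorem4 : (k : ℕ) → 6 ≤ k →
    (m : ℕ) (W : Fin m → PVertex (suc (suc (6 * k)))) → Injective _≡_ _≡_ W →
    Resolving (suc (suc (6 * k))) W → 4 ≤ m
theorem4 k 6≤k m W _ resolving = ≮⇒≥ λ m<4 →
  let x , x∈translates = common-family (≤-pred m<4) (λ l → anchor (W l))
  in u≢u⊕2 (index x) (resolving (u (index x)) (u (index x ⊕ 2)) λ l d d′ isDist isDist′ → begin
       d                                 ≡⟨ distance-formula isDist ⟩
       distance (u (index x)) (W l)      ≡⟨ unresolved x (W l) (x∈translates l) ⟩
       distance (u (index x ⊕ 2)) (W l)  ≡⟨ distance-formula isDist′ ⟨
       d′                                ∎)
  where
  open UnresolvedPairs k 6≤k
  open ≡-Reasoning
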